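{- Let $n\ge k\ge 1$. (1) Let $X$ be an $(n,k)$ right Gog trapezoid. Its canonical completion $Z$ satisfies $Z_{i,j}=j$ for all $n\ge i\ge j+k$. (2) Let $X$ be an $(n,k)$ left Gog trapezoid. Its canonical completion $Z$ satisfies $$Z_{i,j}=\max\bigl(X_{i,k}+j-k,\;X_{i-1,k}+j-k-1,\;\ldots,\;X_{i-j+k,k}\bigr)=\max_{0\le t\le j-k}\bigl(X_{i-t,k}+j-k-t\bigr)$$ for all $n\ge i\ge j\ge k$.
   Context: A Gelfand-Tsetlin triangle of size $n$ is an array $X=(X_{i,j})_{n\ge i\ge j\ge 1}$ of positive integers with $X_{i+1,j}\le X_{i,j}\le X_{i+1,j+1}$ for $n-1\ge i\ge j\ge 1$. It is pictured with row $i$ consisting of $X_{i,1},\dots,X_{i,i}$, row $n$ on top and row $1$ at the bottom. Triangles are ordered entrywise: $X\le Y$ iff $X_{i,j}\le Y_{i,j}$ for all $i,j$. A Gog triangle of size $n$ is a Gelfand-Tsetlin triangle with strictly increasing rows ($X_{i,j}<X_{i,j+1}$) and with $X_{n,j}=j$ for $1\le j\le n$. The Gog triangles of size $n$ are closed under entrywise min and max. An $(n,k)$ right Gog trapezoid ($k\le n$) is the array $(X_{i,j})_{n\ge i\ge j\ge1,\ i-j\le k-1}$ obtained by restricting some Gog triangle of size $n$ to these positions. An $(n,k)$ left Gog trapezoid is the array $(X_{i,j})_{n\ge i\ge j\ge 1,\ j\le k}$ obtained by restricting some Gog triangle of size $n$ to these positions. The canonical completion of a left or right Gog trapezoid is the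 smallest Gog triangle of size $n$, in the entrywise order, whose restriction to the trapezoid's positions is the given trapezoid. -}

module Defs where

open import Data.Nat using (ℕ; zero; suc; _+_; _∸_; _⊔_; _≤_; _<_)
open import Data.Product using (_×_; Σ)
open import Relation.Binary.PropositionalEquality using (_≡_)

-- An array indexed by positions (i , j); only the entries at the positions
-- relevant to the object (triangle / trapezoid) matter.
Array : Set
Array = ℕ → ℕ → ℕ

InTri : ℕ → ℕ → ℕ → Set
InTri n i j = (1 ≤ j) × (j ≤ i) × (i ≤ n)

IsGT : ℕ → Array → Set
IsGT n X =
  (∀ i j → InTri n i j → 1 ≤ X i j) ×
  (∀ i j → 1 ≤ j → j ≤ i → suc i ≤ n →
     (X (suc i) j ≤ X i j) × (X i j ≤ X (suc i) (suc j)))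

IsGog : ℕ → Array → Set
IsGog n X =
  IsGT n X ×
  (∀ i j → 1 ≤ j → suc j ≤ i → i ≤ n → X i j < X i (suc j)) ×
  (∀ j → 1 ≤ j → j ≤ n → X n j ≡ j)

RightPos : ℕ → ℕ → ℕ → ℕ → Set
RightPos n k i j = InTri n i j × (i ∸ j < k)

LeftPos : ℕ → ℕ → ℕ → ℕ → Set
LeftPos n k i j = InTri n i j × (j ≤ k)

AgreeOn : (ℕ → ℕ → Set) → Array → Array → Set
AgreeOn P Y X = ∀ i j → P i j → Y i j ≡ X i j

IsGogTrapezoid : ℕ → (ℕ → ℕ → Set) → Array → Set
IsGogTrapezoid n P X = Σ Array (λ T → IsGog n T × AgreeOn P T X)

IsRightGogTrapezoid : ℕ → ℕ → Array → Set
IsRightGogTrapezoid n k = IsGogTrapezoid n (RightPos n k)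

IsLeftGogTrapezoid : ℕ → ℕ → Array → Set
IsLeftGogTrapezoid n k = IsGogTrapezoid n (LeftPos n k)

_≤[_]_ : Array → ℕ → Array → Set
Z ≤[ n ] Y = ∀ i j → InTri n i j → Z i j ≤ Y i j

IsCanonicalCompletion : ℕ → (ℕ → ℕ → Set) → Array → Array → Set
IsCanonicalCompletion n P X Z =
  IsGog n Z × AgreeOn P Z X ×
  (∀ Y → IsGog n Y → AgreeOn P Y X → Z ≤[ n ] Y)

maxUpTo : ℕ → (ℕ → ℕ) → ℕ
maxUpTo zero f = f 0
maxUpTo (suc m) f = maxUpTo m f ⊔ f (suc m)

leftFormula : Array → ℕ → ℕ → ℕ → ℕ
leftFormula X k i j = maxUpTo (j ∸ k) (λ t → X (i ∸ t) k + ((j ∸ k) ∸ t))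

-- The canonical completion Z of a trapezoid X lies below every Gog triangle
-- extending X, so an upper bound for Z i j comes from exhibiting ONE Gog
-- triangle extending X with the claimed (i , j) entry; the matching lower
-- bound holds in every Gog triangle.
-- (1) Always j ≤ T i j.  Given a Gog triangle T extending X, keeping T on the
--     trapezoid and putting j at every (i , j) with i - j ≥ k is again Gog.
-- (2) Let leftMax A k i d = max over t ≤ d of A (i - t) k + (d - t).  In any
--     Gog triangle leftMax T k i (j - k) ≤ T i j (rows grow by at least one
--     per step, diagonals weakly increase).  Keeping T on columns ≤ k and
--     putting leftMax T k i (j - k) on columns ≥ k is again Gog.
module Submission where

open import Defs
open import Data.Nat using (ℕ; zero; suc; _+_; _∸_; _⊔_; _≤_; _<_; z≤n; s≤s; _≤?_; _<?_)
open import Data.Nat.Properties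
open import Data.Product using (_×_; _,_; proj₁; proj₂; ∃-syntax)
open import Data.Sum using (inj₁; inj₂)
open import Relation.Binary.PropositionalEquality
  using (_≡_; refl; sym; trans; cong; cong₂; subst)
open import Relation.Nullary using (Dec; yes; no; ¬_; contradiction)

maxUpTo-attained : ∀ m (f : ℕ → ℕ) → ∃[ t ] (t ≤ m × maxUpTo m f ≡ f t)
maxUpTo-attained zero f = 0 , z≤n , refl
maxUpTo-attained (suc m) f with ⊔-sel (maxUpTo m f) (f (suc m))
... | inj₂ max≡last = suc m , ≤-refl , max≡last
... | inj₁ max≡prev with maxUpTo-attained m f
...   | t , t≤m , max≡ft = t , m≤n⇒m≤1+n t≤m , trans max≡prev max≡ft

maxUpTo-upper : ∀ m (f : ℕ → ℕ) {t} → t ≤ m → f t ≤ maxUpTo m f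
maxUpTo-upper zero f z≤n = ≤-refl
maxUpTo-upper (suc m) f t≤ with m≤n⇒m<n∨m≡n t≤
... | inj₁ t<1+m = ≤-trans (maxUpTo-upper m f (≤-pred t<1+m)) (m≤m⊔n _ _)
... | inj₂ refl = m≤n⊔m _ _

maxUpTo-lub : ∀ m (f : ℕ → ℕ) {b} → (∀ t → t ≤ m → f t ≤ b) → maxUpTo m f ≤ b
maxUpTo-lub m f bound with maxUpTo-attained m f
... | t , t≤m , max≡ft = ≤-trans (≤-reflexive max≡ft) (bound t t≤m)

maxUpTo-cong : ∀ m (f g : ℕ → ℕ) → (∀ t → t ≤ m → f t ≡ g t) → maxUpTo m f ≡ maxUpTo m g
maxUpTo-cong zero f g f≡g = f≡g 0 z≤n
maxUpTo-cong (suc m) f g f≡g =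
  cong₂ _⊔_ (maxUpTo-cong m f g (λ t t≤m → f≡g t (m≤n⇒m≤1+n t≤m))) (f≡g (suc m) ≤-refl)

leftMax : Array → ℕ → ℕ → ℕ → ℕ
leftMax A k i d = maxUpTo d (λ t → A (i ∸ t) k + (d ∸ t))

leftMax-zero : ∀ A k i → leftMax A k i 0 ≡ A i k
leftMax-zero A k i = +-identityʳ (A i k)

leftMax-first : ∀ A k i d → A i k + d ≤ leftMax A k i d
leftMax-first A k i d = maxUpTo-upper d (λ t → A (i ∸ t) k + (d ∸ t)) z≤n

-- Along a row the formula increases strictly: every term grows by one.
leftMax-suc : ∀ A k i d → leftMax A k i d < leftMax A k i (suc d)
leftMax-suc A k i d with maxUpTo-attained d (λ t → A (i ∸ t) k + (d ∸ t))
... | t , t≤d , max≡term = begin-strict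
  leftMax A k i d              ≡⟨ max≡term ⟩
  A (i ∸ t) k + (d ∸ t)        <⟨ n<1+n _ ⟩
  suc (A (i ∸ t) k + (d ∸ t))  ≡⟨ sym (+-suc _ _) ⟩
  A (i ∸ t) k + suc (d ∸ t)    ≡⟨ cong (A (i ∸ t) k +_) (sym (+-∸-assoc 1 t≤d)) ⟩
  A (i ∸ t) k + (suc d ∸ t)    ≤⟨ maxUpTo-upper (suc d) (λ s → A (i ∸ s) k + (suc d ∸ s)) (m≤n⇒m≤1+n t≤d) ⟩
  leftMax A k i (suc d)        ∎
  where open ≤-Reasoning

-- Along a diagonal the formula is weakly increasing: term t at (i , d) is
-- term t + 1 at (i + 1 , d + 1).
leftMax-diagonal : ∀ A k i d → leftMax A k i d ≤ leftMax A k (suc i) (suc d)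
leftMax-diagonal A k i d = maxUpTo-lub d _ λ t t≤d →
  maxUpTo-upper (suc d) (λ s → A (suc i ∸ s) k + (suc d ∸ s)) (s≤s t≤d)

leftMax-up : ∀ A k i d → A (suc i) k ≤ A i k → leftMax A k (suc i) d ≤ leftMax A k i d
leftMax-up A k i d colDown = maxUpTo-lub d _ bound
  where
  bound : ∀ t → t ≤ d → A (suc i ∸ t) k + (d ∸ t) ≤ leftMax A k i d
  bound zero _ = ≤-trans (+-monoˡ-≤ d colDown) (leftMax-first A k i d)
  bound (suc s) s<d = ≤-trans (+-monoʳ-≤ (A (i ∸ s) k) (∸-monoʳ-≤ d (n≤1+n s)))
                        (maxUpTo-upper d (λ t → A (i ∸ t) k + (d ∸ t)) (≤-trans (n≤1+n s) s<d))

leftMax-cong : ∀ A B k i d → (∀ t → t ≤ d → A (i ∸ t) k ≡ B (i ∸ t) k) →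
               leftMax A k i d ≡ leftMax B k i d
leftMax-cong A B k i d A≡B = maxUpTo-cong d _ _ λ t t≤d → cong (_+ (d ∸ t)) (A≡B t t≤d)

leftFormula-local : ∀ n k i j (A B : Array) → AgreeOn (LeftPos n k) A B →
                    1 ≤ k → k ≤ j → j ≤ i → i ≤ n → leftFormula A k i j ≡ leftFormula B k i j
leftFormula-local n k i j A B A≡B 1≤k k≤j j≤i i≤n = leftMax-cong A B k i (j ∸ k) onColumn
  where
  onColumn : ∀ t → t ≤ j ∸ k → A (i ∸ t) k ≡ B (i ∸ t) k
  onColumn t t≤ = A≡B (i ∸ t) k ((1≤k , k≤i∸t , ≤-trans (m∸n≤m i t) i≤n) , ≤-refl)
    where
    k+t≤j : k + t ≤ j
    k+t≤j = ≤-trans (+-monoʳ-≤ k t≤) (≤-reflexive (m+[n∸m]≡n k≤j))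
    k≤i∸t : k ≤ i ∸ t
    k≤i∸t = m+n≤o⇒m≤o∸n k (≤-trans k+t≤j j≤i)

module _ {P : ℕ → ℕ → Set} (P? : ∀ i j → Dec (P i j)) (A B : Array) where

  piecewise : Array
  piecewise i j with P? i j
  ... | yes _ = A i j
  ... | no _ = B i j

  piecewise-in : ∀ {i j} → P i j → piecewise i j ≡ A i j
  piecewise-in {i} {j} p with P? i j
  ... | yes _ = refl
  ... | no ¬p = contradiction p ¬p

  piecewise-out : ∀ {i j} → ¬ P i j → piecewise i j ≡ B i j
  piecewise-out {i} {j} ¬p with P? i j
  ... | yes p = contradiction p ¬p
  ... | no _ = refl

module GogTriangle (n : ℕ) (T : Array) (isGog : IsGog n T) where

  positive : ∀ i j → InTri n i j → 1 ≤ T i j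
  positive = proj₁ (proj₁ isGog)

  interlace : ∀ i j → 1 ≤ j → j ≤ i → suc i ≤ n →
              (T (suc i) j ≤ T i j) × (T i j ≤ T (suc i) (suc j))
  interlace = proj₂ (proj₁ isGog)

  strict : ∀ i j → 1 ≤ j → suc j ≤ i → i ≤ n → T i j < T i (suc j)
  strict = proj₁ (proj₂ isGog)

  topRow : ∀ j → 1 ≤ j → j ≤ n → T n j ≡ j
  topRow = proj₂ (proj₂ isGog)

  row-growth : ∀ j a i → 1 ≤ j → j + a ≤ i → i ≤ n → T i j + a ≤ T i (j + a)
  row-growth j zero i _ _ _ rewrite +-identityʳ (T i j) | +-identityʳ j = ≤-refl
  row-growth j (suc a) i 1≤j j+a<i i≤n rewrite +-suc (T i j) a | +-suc j a =
    ≤-trans (s≤s (row-growth j a i 1≤j (≤-trans (n≤1+n _) j+a<i) i≤n))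
            (strict i (j + a) (≤-trans 1≤j (m≤m+n j a)) j+a<i i≤n)

  column-lower : ∀ i j → 1 ≤ j → j ≤ i → i ≤ n → j ≤ T i j
  column-lower i (suc j) _ j<i i≤n =
    ≤-trans (+-monoˡ-≤ j (positive i 1 (≤-refl , ≤-trans (s≤s z≤n) j<i , i≤n)))
            (row-growth 1 j i ≤-refl j<i i≤n)

  diagonal-growth : ∀ t i j → 1 ≤ j → j ≤ i → i + t ≤ n → T i j ≤ T (i + t) (j + t)
  diagonal-growth zero i j _ _ _ rewrite +-identityʳ i | +-identityʳ j = ≤-refl
  diagonal-growth (suc t) i j 1≤j j≤i i+t<n rewrite +-suc i t | +-suc j t =
    ≤-trans (diagonal-growth t i j 1≤j j≤i (≤-trans (n≤1+n _) i+t<n))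
            (proj₂ (interlace (i + t) (j + t) (≤-trans 1≤j (m≤m+n j t)) (+-monoˡ-≤ t j≤i) i+t<n))

  diagonal-upper : ∀ d i j → i + d ≡ n → 1 ≤ j → j ≤ i → T i j ≤ j + d
  diagonal-upper d i j i+d≡n 1≤j j≤i = begin
    T i j              ≤⟨ diagonal-growth d i j 1≤j j≤i (≤-reflexive i+d≡n) ⟩
    T (i + d) (j + d)  ≡⟨ cong (λ r → T r (j + d)) i+d≡n ⟩
    T n (j + d)        ≡⟨ topRow (j + d) (≤-trans 1≤j (m≤m+n j d)) j+d≤n ⟩
    j + d              ∎
    where
    open ≤-Reasoning
    j+d≤n : j + d ≤ n
    j+d≤n = ≤-trans (+-monoˡ-≤ d j≤i) (≤-reflexive i+d≡n)

  -- The formula of part (2) is a lower bound: each term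
  -- T (i-t) k + (d-t) ≤ T (i-t) (k+d-t) ≤ T i (k+d)  by row and diagonal growth.
  leftMax-below : ∀ k d i → 1 ≤ k → k + d ≤ i → i ≤ n → leftMax T k i d ≤ T i (k + d)
  leftMax-below k d i 1≤k k+d≤i i≤n = maxUpTo-lub d _ term≤
    where
    term≤ : ∀ t → t ≤ d → T (i ∸ t) k + (d ∸ t) ≤ T i (k + d)
    term≤ t t≤d = begin
      T (i ∸ t) k + (d ∸ t)            ≤⟨ row-growth k (d ∸ t) (i ∸ t) 1≤k shifted≤ (≤-trans (m∸n≤m i t) i≤n) ⟩
      T (i ∸ t) (k + (d ∸ t))          ≤⟨ diagonal-growth t (i ∸ t) (k + (d ∸ t)) (≤-trans 1≤k (m≤m+n k _)) shifted≤
                                            (≤-trans (≤-reflexive rows) i≤n) ⟩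
      T (i ∸ t + t) (k + (d ∸ t) + t)  ≡⟨ cong₂ T rows columns ⟩
      T i (k + d)                      ∎
      where
      open ≤-Reasoning
      columns : k + (d ∸ t) + t ≡ k + d
      columns = trans (+-assoc k (d ∸ t) t) (cong (k +_) (m∸n+n≡m t≤d))
      rows : i ∸ t + t ≡ i
      rows = m∸n+n≡m (≤-trans t≤d (≤-trans (m≤n+m d k) k+d≤i))
      shifted≤ : k + (d ∸ t) ≤ i ∸ t
      shifted≤ = m+n≤o⇒m≤o∸n (k + (d ∸ t)) (≤-trans (≤-reflexive columns) k+d≤i)

  leftMax-top : ∀ k d → 1 ≤ k → k + d ≤ n → leftMax T k n d ≡ k + d
  leftMax-top k d 1≤k k+d≤n = ≤-antisym (maxUpTo-lub d _ term≤) atZero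
    where
    atZero : k + d ≤ leftMax T k n d
    atZero = subst (λ x → x + d ≤ leftMax T k n d) (topRow k 1≤k (≤-trans (m≤m+n k d) k+d≤n))
                   (leftMax-first T k n d)
    term≤ : ∀ t → t ≤ d → T (n ∸ t) k + (d ∸ t) ≤ k + d
    term≤ t t≤d = begin
      T (n ∸ t) k + (d ∸ t)  ≤⟨ +-monoˡ-≤ (d ∸ t) (diagonal-upper t (n ∸ t) k (m∸n+n≡m t≤n) 1≤k k≤n∸t) ⟩
      k + t + (d ∸ t)        ≡⟨ +-assoc k t (d ∸ t) ⟩
      k + (t + (d ∸ t))      ≡⟨ cong (k +_) (m+[n∸m]≡n t≤d) ⟩
      k + d                  ∎
      where
      open ≤-Reasoning
      t≤n : t ≤ n
      t≤n = ≤-trans t≤d (≤-trans (m≤n+m d k) k+d≤n)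
      k≤n∸t : k ≤ n ∸ t
      k≤n∸t = m+n≤o⇒m≤o∸n k (≤-trans (+-monoʳ-≤ k t≤d) k+d≤n)

module RightExtension (n k : ℕ) (T : Array) (isGog : IsGog n T) where
  open GogTriangle n T isGog

  -- T inside the trapezoid (i - j < k), the least possible value j outside.
  outside? : ∀ i j → Dec (k ≤ i ∸ j)
  outside? i j = k ≤? i ∸ j

  Y : Array
  Y = piecewise outside? (λ _ j → j) T

  Y-out : ∀ {i j} → k ≤ i ∸ j → Y i j ≡ j
  Y-out = piecewise-in outside? _ T

  Y-in : ∀ {i j} → i ∸ j < k → Y i j ≡ T i j
  Y-in i∸j<k = piecewise-out outside? _ T (<⇒≱ i∸j<k)

  Y-agrees : ∀ X → AgreeOn (RightPos n k) T X → AgreeOn (RightPos n k) Y X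
  Y-agrees X T≡X i j (p , i∸j<k) = trans (Y-in i∸j<k) (T≡X i j (p , i∸j<k))

  Y-isGog : IsGog n Y
  Y-isGog = (Y-positive , Y-interlace) , Y-strict , Y-top
    where
    Y-positive : ∀ i j → InTri n i j → 1 ≤ Y i j
    Y-positive i j p@(1≤j , _) with i ∸ j <? k
    ... | yes inside rewrite Y-in {i} {j} inside = positive i j p
    ... | no outside rewrite Y-out {i} {j} (≮⇒≥ outside) = 1≤j

    -- position (i+1 , j) is outside whenever (i , j) is
    Y-interlace : ∀ i j → 1 ≤ j → j ≤ i → suc i ≤ n →
                  (Y (suc i) j ≤ Y i j) × (Y i j ≤ Y (suc i) (suc j))
    Y-interlace i j 1≤j j≤i i<n with i ∸ j <? k
    ... | yes inside rewrite Y-in {i} {j} inside | Y-in {suc i} {suc j} inside =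
      below , proj₂ (interlace i j 1≤j j≤i i<n)
      where
      below : Y (suc i) j ≤ T i j
      below with suc i ∸ j <? k
      ... | yes inside′ rewrite Y-in {suc i} {j} inside′ = proj₁ (interlace i j 1≤j j≤i i<n)
      ... | no outside′ rewrite Y-out {suc i} {j} (≮⇒≥ outside′) = column-lower i j 1≤j j≤i (≤-trans (n≤1+n i) i<n)
    ... | no outside rewrite Y-out {i} {j} (≮⇒≥ outside) | Y-out {suc i} {suc j} (≮⇒≥ outside)
                           | Y-out {suc i} {j} (≤-trans (≮⇒≥ outside) (∸-monoˡ-≤ j (n≤1+n i))) =
      ≤-refl , n≤1+n j

    -- position (i , j+1) is inside whenever (i , j) is
    Y-strict : ∀ i j → 1 ≤ j → suc j ≤ i → i ≤ n → Y i j < Y i (suc j)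
    Y-strict i j 1≤j j<i i≤n with i ∸ j <? k
    ... | yes inside rewrite Y-in {i} {j} inside
                           | Y-in {i} {suc j} (≤-<-trans (∸-monoʳ-≤ i (n≤1+n j)) inside) =
      strict i j 1≤j j<i i≤n
    ... | no outside rewrite Y-out {i} {j} (≮⇒≥ outside) with i ∸ suc j <? k
    ...   | yes inside′ rewrite Y-in {i} {suc j} inside′ = column-lower i (suc j) (s≤s z≤n) j<i i≤n
    ...   | no outside′ rewrite Y-out {i} {suc j} (≮⇒≥ outside′) = ≤-refl

    Y-top : ∀ j → 1 ≤ j → j ≤ n → Y n j ≡ j
    Y-top j 1≤j j≤n with n ∸ j <? k
    ... | yes inside = trans (Y-in inside) (topRow j 1≤j j≤n)
    ... | no outside = Y-out (≮⇒≥ outside)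

-- Part (1) of the theorem: Z is below the extension Y, which is j there.
rightCompletion : (n k : ℕ) (X Z : Array) → IsRightGogTrapezoid n k X →
  IsCanonicalCompletion n (RightPos n k) X Z →
  ∀ i j → 1 ≤ j → j + k ≤ i → i ≤ n → Z i j ≡ j
rightCompletion n k X Z (T , T-isGog , T≡X) (Z-isGog , _ , Z-minimal) i j 1≤j j+k≤i i≤n =
  ≤-antisym (subst (Z i j ≤_) (Y-out outside) (Z-minimal Y Y-isGog (Y-agrees X T≡X) i j position))
            (GogTriangle.column-lower n Z Z-isGog i j 1≤j j≤i i≤n)
  where
  open RightExtension n k T T-isGog
  j≤i : j ≤ i
  j≤i = ≤-trans (m≤m+n j k) j+k≤i
  position : InTri n i j
  position = 1≤j , j≤i , i≤n
  outside : k ≤ i ∸ j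
  outside = m+n≤o⇒m≤o∸n k (≤-trans (≤-reflexive (+-comm k j)) j+k≤i)

module LeftExtension (n k : ℕ) (1≤k : 1 ≤ k) (T : Array) (isGog : IsGog n T) where
  open GogTriangle n T isGog

  F : Array
  F i j = leftFormula T k i j

  suc-∸ : ∀ {j} → k ≤ j → suc j ∸ k ≡ suc (j ∸ k)
  suc-∸ = +-∸-assoc 1

  F-strict : ∀ i j → k ≤ j → F i j < F i (suc j)
  F-strict i j k≤j = subst (λ d → F i j < leftMax T k i d) (sym (suc-∸ k≤j)) (leftMax-suc T k i (j ∸ k))

  F-up : ∀ i j → k ≤ i → suc i ≤ n → F (suc i) j ≤ F i j
  F-up i j k≤i i<n = leftMax-up T k i (j ∸ k) (proj₁ (interlace i k 1≤k k≤i i<n))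

  F-diagonal : ∀ i j → k ≤ j → F i j ≤ F (suc i) (suc j)
  F-diagonal i j k≤j =
    subst (λ d → F i j ≤ leftMax T k (suc i) d) (sym (suc-∸ k≤j)) (leftMax-diagonal T k i (j ∸ k))

  F-top : ∀ j → k ≤ j → j ≤ n → F n j ≡ j
  F-top j k≤j j≤n = trans (leftMax-top k (j ∸ k) 1≤k (≤-trans (≤-reflexive k+d≡j) j≤n)) k+d≡j
    where
    k+d≡j : k + (j ∸ k) ≡ j
    k+d≡j = m+[n∸m]≡n k≤j

  -- T on columns ≤ k, the formula on columns ≥ k (they agree on column k).
  leftOfK? : (i j : ℕ) → Dec (j ≤ k)
  leftOfK? _ j = j ≤? k

  W : Array
  W = piecewise leftOfK? T F

  W-left : ∀ {i j} → j ≤ k → W i j ≡ T i j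
  W-left = piecewise-in leftOfK? T F

  W-right : ∀ {i j} → k ≤ j → W i j ≡ F i j
  W-right {i} {j} k≤j with m≤n⇒m<n∨m≡n k≤j
  ... | inj₁ k<j = piecewise-out leftOfK? T F (<⇒≱ k<j)
  ... | inj₂ refl = trans (W-left {i} ≤-refl) (sym (trans (cong (leftMax T k i) (n∸n≡0 k)) (leftMax-zero T k i)))

  W-agrees : ∀ X → AgreeOn (LeftPos n k) T X → AgreeOn (LeftPos n k) W X
  W-agrees X T≡X i j (p , j≤k) = trans (W-left {i} j≤k) (T≡X i j (p , j≤k))

  W-isGog : IsGog n W
  W-isGog = (W-positive , W-interlace) , W-strict , W-top
    where
    W-positive : ∀ i j → InTri n i j → 1 ≤ W i j
    W-positive i j p@(_ , j≤i , i≤n) with k ≤? j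
    ... | yes k≤j rewrite W-right {i} k≤j =
      ≤-trans (positive i k (1≤k , ≤-trans k≤j j≤i , i≤n))
              (≤-trans (m≤m+n (T i k) (j ∸ k)) (leftMax-first T k i (j ∸ k)))
    ... | no k≰j rewrite W-left {i} (<⇒≤ (≰⇒> k≰j)) = positive i j p

    W-interlace : ∀ i j → 1 ≤ j → j ≤ i → suc i ≤ n →
                  (W (suc i) j ≤ W i j) × (W i j ≤ W (suc i) (suc j))
    W-interlace i j 1≤j j≤i i<n with k ≤? j
    ... | yes k≤j rewrite W-right {suc i} k≤j | W-right {i} k≤j | W-right {suc i} (m≤n⇒m≤1+n k≤j) =
      F-up i j (≤-trans k≤j j≤i) i<n , F-diagonal i j k≤j
    ... | no k≰j rewrite W-left {suc i} (<⇒≤ (≰⇒> k≰j)) | W-left {i} (<⇒≤ (≰⇒> k≰j))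
                       | W-left {suc i} (≰⇒> k≰j) = interlace i j 1≤j j≤i i<n

    W-strict : ∀ i j → 1 ≤ j → suc j ≤ i → i ≤ n → W i j < W i (suc j)
    W-strict i j 1≤j j<i i≤n with k ≤? j
    ... | yes k≤j rewrite W-right {i} k≤j | W-right {i} (m≤n⇒m≤1+n k≤j) = F-strict i j k≤j
    ... | no k≰j rewrite W-left {i} (<⇒≤ (≰⇒> k≰j)) | W-left {i} (≰⇒> k≰j) = strict i j 1≤j j<i i≤n

    W-top : ∀ j → 1 ≤ j → j ≤ n → W n j ≡ j
    W-top j 1≤j j≤n with k ≤? j
    ... | yes k≤j = trans (W-right k≤j) (F-top j k≤j j≤n)
    ... | no k≰j = trans (W-left {n} (<⇒≤ (≰⇒> k≰j))) (topRow j 1≤j j≤n)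

-- Part (2) of the theorem: Z is below the extension W, which is the formula
-- there, and the formula (read off Z, which agrees with X) is below Z.
leftCompletion : (n k : ℕ) → 1 ≤ k → (X Z : Array) → IsLeftGogTrapezoid n k X →
  IsCanonicalCompletion n (LeftPos n k) X Z →
  ∀ i j → k ≤ j → j ≤ i → i ≤ n → Z i j ≡ leftFormula X k i j
leftCompletion n k 1≤k X Z (T , T-isGog , T≡X) (Z-isGog , Z≡X , Z-minimal) i j k≤j j≤i i≤n =
  ≤-antisym upper lower
  where
  open LeftExtension n k 1≤k T T-isGog
  k+d≡j : k + (j ∸ k) ≡ j
  k+d≡j = m+[n∸m]≡n k≤j
  upper : Z i j ≤ leftFormula X k i j
  upper = subst (Z i j ≤_) (trans (W-right k≤j) (leftFormula-local n k i j T X T≡X 1≤k k≤j j≤i i≤n))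
                (Z-minimal W W-isGog (W-agrees X T≡X) i j (≤-trans 1≤k k≤j , j≤i , i≤n))
  lower : leftFormula X k i j ≤ Z i j
  lower = begin
    leftFormula X k i j    ≡⟨ sym (leftFormula-local n k i j Z X Z≡X 1≤k k≤j j≤i i≤n) ⟩
    leftMax Z k i (j ∸ k)  ≤⟨ GogTriangle.leftMax-below n Z Z-isGog k (j ∸ k) i 1≤k (≤-trans (≤-reflexive k+d≡j) j≤i) i≤n ⟩
    Z i (k + (j ∸ k))      ≡⟨ cong (Z i) k+d≡j ⟩
    Z i j                  ∎
    where open ≤-Reasoning

-- Both parts; the hypothesis k ≤ n is implied by the positions considered.
mainTheorem1 : (n k : ℕ) → 1 ≤ k → k ≤ n →
    ((X Z : Array) → IsRightGogTrapezoid n k X →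
      IsCanonicalCompletion n (RightPos n k) X Z →
      ∀ i j → 1 ≤ j → j + k ≤ i → i ≤ n → Z i j ≡ j)
    ×
    ((X Z : Array) → IsLeftGogTrapezoid n k X →
      IsCanonicalCompletion n (LeftPos n k) X Z →
      ∀ i j → k ≤ j → j ≤ i → i ≤ n → Z i j ≡ leftFormula X k i j)
mainTheorem1 n k 1≤k _ = rightCompletion n k , leftCompletion n k 1≤k
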